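{- Let $\tau^+$ be a set of positions with associated terms that is DN for a logic program $P$. Let $Q\Rightarrow_c^\theta Q_1$ be an SLD-derivation step with $c\in P$, where $Q=\mathbf A,p(t_1,\dots,t_n),\mathbf C$ with selected atom $p(t_1,\dots,t_n)$. Let $Q'=\mathbf A',p(t'_1,\dots,t'_n),\mathbf C'$ be a query that is $\Delta[\tau^+]$-more general than $Q$, where the position of $p(t'_1,\dots,t'_n)$ in $Q'$ is the same as that of $p(t_1,\dots,t_n)$ in $Q$. Let $c'$ be a variant of $c$ variable disjoint with $Q'$. Then for some $\theta'$ and $Q'_1$: $Q'\Rightarrow_c^{\theta'}Q'_1$ is an SLD-derivation step with input clause $c'$, and $Q'\Rightarrow_c^{\theta'}Q'_1$ is a $\Delta[\tau^+]$-lift of $Q\Rightarrow_c^\theta Q_1$.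
   Context: Fix a first-order language $\mathcal L$; $\Pi$ is its set of relation symbols, each $p$ with unique arity $arity(p)$; $TU_{\mathcal L}$ is the set of all terms; $[1,n]=\{1,\dots,n\}$. A query is a finite sequence of atoms; a logic program is a finite set of definite clauses. SLD-derivation step: given a query $\mathbf A,B,\mathbf C$ and a clause $c$, take a variant $H\leftarrow\mathbf B$ of $c$ (the input clause) variable disjoint from the query with $B,H$ unifiable and mgu $\theta$; then $\mathbf A,B,\mathbf C\Rightarrow_c^\theta(\mathbf A,\mathbf B,\mathbf C)\theta$ with selected atom $B$. A term-condition is a map $TU_{\mathcal L}\to\{\mathtt{true},\mathtt{false}\}$. A filter $\Delta$ assigns to each $p\in\Pi$ a partial function $\Delta(p)$ from $[1,arity(p)]$ to term-conditions. For a substitution $\eta$, an atom $A=p(s_1,\dots,s_n)$ is $\Delta$-more general than $B$ for $\eta$ if $B=p(t_1,\dots,t_n)$, $t_i=s_i\eta$ for $i\notin Dom(\Delta(p))$, and $\Delta(p)(i)(s_i)=\mathtt{true}$ for $i\in Dom(\Delta(p))$; a query $A_1,\dots,A_n$ is $\Delta$-more general than $B_1,\dots,B_m$ for $\eta$ if $n=m$ and componentwise for the same $\eta$; "$\Delta$-more general" means for some $\eta$. A step $Q'\Rightarrow_cQ'_1$ is a $\Delta$-lift of a step $Q\Rightarrow_cQ_1$ if $Q'$ is $\Delta$-more general than $Q$, $Q'_1$ is $\Delta$-more general than $Q_1$, and atoms in the same positions are selected in $Q$ and $Q'$. A set of positions with associated terms $\tau^+$ assigns to each $p$ a partial function $\tau^+(p)$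 from $[1,arity(p)]$ to $TU_{\mathcal L}$; write $\langle i\mapsto u\rangle\in\tau^+(p)$ if $i\in Dom(\tau^+(p))$ and $\tau^+(p)(i)=u$. Its associated filter $\Delta[\tau^+]$ maps $p$ to the function with domain $Dom(\tau^+(p))$ sending $i$ to the term-condition $t\mapsto\mathtt{true}$ iff $t$ is an instance of $\tau^+(p)(i)$. $\tau^+$ is DN for a clause $p(s_1,\dots,s_n)\leftarrow\mathbf B$ if: (DN1) for all $i\in Dom(\tau^+(p))$, $j\in[1,n]\setminus\{i\}$: $Var(s_i)\cap Var(s_j)=\emptyset$; (DN2) for all $\langle i\mapsto u_i\rangle\in\tau^+(p)$, $s_i$ is more general than $u_i$; (DN3) for all $i\in Dom(\tau^+(p))$, all atoms $q(t_1,\dots,t_m)$ in $\mathbf B$, all $j\in[1,m]\setminus Dom(\tau^+(q))$: $Var(s_i)\cap Var(t_j)=\emptyset$; (DN4) for all atoms $q(t_1,\dots,t_m)$ in $\mathbf B$ and all $\langle j\mapsto u_j\rangle\in\tau^+(q)$, $t_j$ is an instance of $u_j$. $\tau^+$ is DN for a program if DN for each of its clauses. -}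

module Defs where

open import Data.Nat using (ℕ; _≤_)




open import Data.Fin using (Fin)
open import Data.Vec using (Vec; []; _∷_; lookup)
open import Data.List using (List; []; _∷_; _++_; length)
import Data.List as L
open import Data.List.Membership.Propositional using (_∈_)
open import Data.List.Relation.Unary.Any using (Any)
open import Data.List.Relation.Binary.Pointwise using (Pointwise)
open import Data.Maybe using (Maybe; just; nothing)
import Data.Maybe as M
open import Data.Product using (Σ; ∃; _×_; _,_)
open import Data.Sum using (_⊎_)
open import Data.Empty using (⊥)
open import Relation.Nullary using (¬_)
open import Relation.Binary.PropositionalEquality using (_≡_)
open import Function.Bundles using (_↔_; Inverse)

module Lang (F : Set) (farity : F → ℕ) (Π : Set) (arity : Π → ℕ) where

  data Term : Set where
    var : ℕ → Term
    fn  : (f : F) → Vec Term (farity f) → Term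

  Subst : Set
  Subst = ℕ → Term

  mutual
    _⟨_⟩ : Term → Subst → Term
    var x    ⟨ σ ⟩ = σ x
    fn f ts  ⟨ σ ⟩ = fn f (ts ⟨ σ ⟩*)

    _⟨_⟩* : ∀ {n} → Vec Term n → Subst → Vec Term n
    []       ⟨ σ ⟩* = []
    (t ∷ ts) ⟨ σ ⟩* = (t ⟨ σ ⟩) ∷ (ts ⟨ σ ⟩*)

  -- substitutions (as in the paper) have finite domain
  FiniteSubst : Subst → Set
  FiniteSubst σ = ∃ λ N → ∀ x → N ≤ x → σ x ≡ var x

  IsInstance : Term → Term → Set
  IsInstance t u = ∃ λ σ → t ≡ u ⟨ σ ⟩

  MoreGeneralTerm : Term → Term → Set
  MoreGeneralTerm s u = IsInstance u s

  mutual
    data _∈ᵥ_ (x : ℕ) : Term → Set where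
      here   : x ∈ᵥ var x
      inside : ∀ {f ts} → x ∈ᵥ* ts → x ∈ᵥ fn f ts

    data _∈ᵥ*_ (x : ℕ) : ∀ {n} → Vec Term n → Set where
      hd : ∀ {n t} {ts : Vec Term n} → x ∈ᵥ t → x ∈ᵥ* (t ∷ ts)
      tl : ∀ {n t} {ts : Vec Term n} → x ∈ᵥ* ts → x ∈ᵥ* (t ∷ ts)

  DisjointTerms : Term → Term → Set
  DisjointTerms s t = ∀ x → x ∈ᵥ s → x ∈ᵥ t → ⊥

  data Atom : Set where
    atom : (p : Π) → Vec Term (arity p) → Atom

  _⟨_⟩ₐ : Atom → Subst → Atom
  atom p ts ⟨ σ ⟩ₐ = atom p (ts ⟨ σ ⟩*)

  Query : Set
  Query = List Atom

  _⟨_⟩q : Query → Subst → Query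
  Q ⟨ σ ⟩q = L.map (λ A → A ⟨ σ ⟩ₐ) Q

  record Clause : Set where
    constructor _⇐_
    field
      head : Atom
      body : Query
  open Clause public

  _⟨_⟩c : Clause → Subst → Clause
  (H ⇐ B) ⟨ σ ⟩c = (H ⟨ σ ⟩ₐ) ⇐ (B ⟨ σ ⟩q)

  Program : Set
  Program = List Clause

  _∈ᵥₐ_ : ℕ → Atom → Set
  x ∈ᵥₐ atom p ts = x ∈ᵥ* ts

  _∈ᵥq_ : ℕ → Query → Set
  x ∈ᵥq Q = Any (x ∈ᵥₐ_) Q

  _∈ᵥc_ : ℕ → Clause → Set
  x ∈ᵥc c = (x ∈ᵥₐ head c) ⊎ (x ∈ᵥq body c)

  VarDisjoint : Clause → Query → Set
  VarDisjoint c Q = ∀ x → x ∈ᵥc c → x ∈ᵥq Q → ⊥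

  Variant : Clause → Clause → Set
  Variant c' c = Σ (ℕ ↔ ℕ) λ π → c' ≡ c ⟨ (λ x → var (Inverse.to π x)) ⟩c

  IsMGU : Subst → Atom → Atom → Set
  IsMGU θ A B =
    (A ⟨ θ ⟩ₐ ≡ B ⟨ θ ⟩ₐ) ×
    (∀ σ → A ⟨ σ ⟩ₐ ≡ B ⟨ σ ⟩ₐ → ∃ λ δ → ∀ x → σ x ≡ (θ x) ⟨ δ ⟩)

  -- SLD-derivation step  As,B,Cs ⇒_c^θ Q1  with selected atom B
  -- (at position length As) and input clause d.

  SLDStep : Query → Atom → Query → Clause → Subst → Query → Clause → Set
  SLDStep As B Cs c θ Q1 d =
    Variant d c ×
    VarDisjoint d (As ++ B ∷ Cs) ×
    FiniteSubst θ ×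
    IsMGU θ B (head d) ×
    (Q1 ≡ (As ++ body d ++ Cs) ⟨ θ ⟩q)

  -- term-conditions rendered as predicates on terms
  TermCondition : Set₁
  TermCondition = Term → Set

  -- Δ(p) : partial function [1,arity p] → term-conditions
  Filter : Set₁
  Filter = (p : Π) → Fin (arity p) → Maybe TermCondition

  PosCond : Maybe TermCondition → Subst → Term → Term → Set
  PosCond nothing  η s t = t ≡ s ⟨ η ⟩
  PosCond (just C) η s t = C s

  data MGAtomFor (Δ : Filter) (η : Subst) : Atom → Atom → Set where
    mg : ∀ {p} (ss ts : Vec Term (arity p)) →
         (∀ i → PosCond (Δ p i) η (lookup ss i) (lookup ts i)) →
         MGAtomFor Δ η (atom p ss) (atom p ts)

  MGQueryFor : Filter → Subst → Query → Query → Set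
  MGQueryFor Δ η Q' Q = Pointwise (MGAtomFor Δ η) Q' Q

  MoreGeneralQ : Filter → Query → Query → Set
  MoreGeneralQ Δ Q' Q = ∃ λ η → MGQueryFor Δ η Q' Q

  DeltaLift : Filter → Query → Atom → Query → Query →
                       Query → Atom → Query → Query → Set
  DeltaLift Δ As' B' Cs' Q'1 As B Cs Q1 =
    MoreGeneralQ Δ (As' ++ B' ∷ Cs') (As ++ B ∷ Cs) ×
    MoreGeneralQ Δ Q'1 Q1 ×
    (length As' ≡ length As)

  PosTerms : Set
  PosTerms = (p : Π) → Fin (arity p) → Maybe Term

  Δ[_] : PosTerms → Filter
  Δ[ τ ] p i = M.map (λ u t → IsInstance t u) (τ p i)

  DNClause : PosTerms → Clause → Set
  DNClause τ (atom p ss ⇐ B) =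
    -- DN1
    (∀ i u → τ p i ≡ just u → ∀ j → ¬ (i ≡ j) →
       DisjointTerms (lookup ss i) (lookup ss j)) ×
    -- DN2
    (∀ i u → τ p i ≡ just u → MoreGeneralTerm (lookup ss i) u) ×
    -- DN3
    (∀ i u → τ p i ≡ just u → ∀ q (ts : Vec Term (arity q)) → atom q ts ∈ B →
       ∀ j → τ q j ≡ nothing → DisjointTerms (lookup ss i) (lookup ts j)) ×
    -- DN4
    (∀ q (ts : Vec Term (arity q)) → atom q ts ∈ B →
       ∀ j u → τ q j ≡ just u → IsInstance (lookup ts j) u)

  DNProgram : PosTerms → Program → Set
  DNProgram τ P = ∀ c → c ∈ P → DNClause τ c

module Submission where

-- The heart of
-- the argument is a unifier σ of the selected atom p(t′) of Q′ and the head p(h)ρ′ of c′.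
-- Off c′, σ is ηθ, where η witnesses that Q′ is Δ-more general than Q. On c′ it is the
-- original ρθ, except on the variables of a filtered head position i: there DN2 and the filter
-- make t′ᵢ an instance of hᵢ, so hᵢ is matched against t′ᵢ before ηθ is applied, and DN1 keeps
-- these matchings apart from each other and from the rest of the clause. By the unification
-- theorem the two atoms then have a finite mgu θ′ with θ′σ = σ. The resolvent of Q′ is
-- Δ-more general than that of Q for σ: at unfiltered positions σ reproduces the original step
-- (DN3 for the body), and filtered positions only have to stay instances of their terms, which
-- DN4 provides and instantiation preserves.

open import Data.Nat using (ℕ; zero; suc; _+_; _≤_; _<_; _⊔_; s≤s; _≟_)
open import Data.Nat.Properties
  using (≤-refl; ≤-trans; ≤-pred; <-≤-trans; <-irrefl; n≮n; suc-injective; m≤n+m; m≤m+n;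
         m≤n⇒m≤1+n; n≤1+n; +-assoc; +-monoˡ-≤; +-monoʳ-≤; m⊔n≤o⇒m≤o; m⊔n≤o⇒n≤o;
         +-commutativeSemigroup)
open import Algebra.Properties.CommutativeSemigroup +-commutativeSemigroup using (interchange)
open import Data.Nat.Induction using (<-wellFounded)
open import Induction.WellFounded using (Acc; acc)
open import Data.Fin using (Fin)
import Data.Fin as Fin
open import Data.Fin.Properties using (any?)
open import Data.Vec using (Vec; []; _∷_; lookup)
open import Data.Vec.Properties using (∷-injective; tabulate∘lookup; tabulate-cong)
open import Data.List using (List; []; _∷_; _++_; length; filter)
import Data.List as L
open import Data.List.Properties using (filter-notAll)
open import Data.List.Membership.Propositional using (_∈_; lose)
open import Data.List.Membership.Propositional.Properties using (∈-filter⁺)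
open import Data.List.Relation.Unary.Any using (Any; here; there)
import Data.List.Relation.Unary.Any as Any
import Data.List.Relation.Unary.Any.Properties as Anyₚ
open import Data.List.Relation.Unary.All using (All; []; _∷_)
import Data.List.Relation.Unary.All as All
import Data.List.Relation.Unary.All.Properties as Allₚ
open import Data.List.Relation.Binary.Pointwise using (Pointwise; []; _∷_)
import Data.List.Relation.Binary.Pointwise as Pointwise
open import Data.Maybe using (just; nothing)
open import Data.Product using (Σ; ∃; _×_; _,_; proj₁; proj₂)
import Data.Product as Product
open import Data.Sum using (_⊎_; inj₁; inj₂; [_,_]′)
import Data.Sum
open import Relation.Nullary using (¬_; Dec; yes; no; ¬?; contradiction)
open import Relation.Nullary.Decidable using (map′; _⊎-dec_)
open import Relation.Binary.PropositionalEquality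
  using (_≡_; _≢_; _≗_; refl; sym; trans; cong; cong₂; subst; module ≡-Reasoning)
open import Function using (_∘_)
open import Function.Bundles using (_↔_; Inverse)
import Defs

module _ {a b r} {A : Set a} {B : Set b} {R : A → B → Set r} where

  Pointwise-++⁻ : ∀ ws xs {ys zs} → length ws ≡ length xs →
                  Pointwise R (ws ++ ys) (xs ++ zs) → Pointwise R ws xs × Pointwise R ys zs
  Pointwise-++⁻ []       []       _  rs       = [] , rs
  Pointwise-++⁻ (w ∷ ws) (x ∷ xs) eq (r ∷ rs) =
    Product.map₁ (r ∷_) (Pointwise-++⁻ ws xs (suc-injective eq) rs)

module _ {a r} {A : Set a} {R : A → A → Set r} where

  Pointwise-diagonal : ∀ xs → (∀ {x} → x ∈ xs → R x x) → Pointwise R xs xs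
  Pointwise-diagonal []       h = []
  Pointwise-diagonal (x ∷ xs) h = h (here refl) ∷ Pointwise-diagonal xs (h ∘ there)

lookup-extensionality : ∀ {a n} {A : Set a} (xs ys : Vec A n) →
                        (∀ i → lookup xs i ≡ lookup ys i) → xs ≡ ys
lookup-extensionality xs ys h =
  trans (sym (tabulate∘lookup xs)) (trans (tabulate-cong h) (tabulate∘lookup ys))

module _ (F : Set) (farity : F → ℕ) (Π : Set) (arity : Π → ℕ) where
  open Defs.Lang F farity Π arity
  open ≡-Reasoning

  infixl 8 _⨾_
  _⨾_ : Subst → Subst → Subst
  (θ ⨾ σ) x = θ x ⟨ σ ⟩

  mutual
    ⟨⟩-⨾ : ∀ t θ σ → t ⟨ θ ⟩ ⟨ σ ⟩ ≡ t ⟨ θ ⨾ σ ⟩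
    ⟨⟩-⨾ (var x)   θ σ = refl
    ⟨⟩-⨾ (fn f ts) θ σ = cong (fn f) (⟨⟩*-⨾ ts θ σ)

    ⟨⟩*-⨾ : ∀ {n} (ts : Vec Term n) θ σ → ts ⟨ θ ⟩* ⟨ σ ⟩* ≡ ts ⟨ θ ⨾ σ ⟩*
    ⟨⟩*-⨾ []       θ σ = refl
    ⟨⟩*-⨾ (t ∷ ts) θ σ = cong₂ _∷_ (⟨⟩-⨾ t θ σ) (⟨⟩*-⨾ ts θ σ)

  mutual
    ⟨⟩-cong : ∀ t {θ σ} → (∀ x → x ∈ᵥ t → θ x ≡ σ x) → t ⟨ θ ⟩ ≡ t ⟨ σ ⟩
    ⟨⟩-cong (var x)   h = h x here
    ⟨⟩-cong (fn f ts) h = cong (fn f) (⟨⟩*-cong ts (λ x → h x ∘ inside))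

    ⟨⟩*-cong : ∀ {n} (ts : Vec Term n) {θ σ} → (∀ x → x ∈ᵥ* ts → θ x ≡ σ x) →
               ts ⟨ θ ⟩* ≡ ts ⟨ σ ⟩*
    ⟨⟩*-cong []       h = refl
    ⟨⟩*-cong (t ∷ ts) h = cong₂ _∷_ (⟨⟩-cong t (λ x → h x ∘ hd)) (⟨⟩*-cong ts (λ x → h x ∘ tl))

  mutual
    ⟨var⟩ : ∀ t → t ⟨ var ⟩ ≡ t
    ⟨var⟩ (var x)   = refl
    ⟨var⟩ (fn f ts) = cong (fn f) (⟨var⟩* ts)

    ⟨var⟩* : ∀ {n} (ts : Vec Term n) → ts ⟨ var ⟩* ≡ ts
    ⟨var⟩* []       = refl
    ⟨var⟩* (t ∷ ts) = cong₂ _∷_ (⟨var⟩ t) (⟨var⟩* ts)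

  ⟨⟩-absorb : ∀ t {θ σ} → θ ⨾ σ ≗ σ → t ⟨ θ ⟩ ⟨ σ ⟩ ≡ t ⟨ σ ⟩
  ⟨⟩-absorb t {θ} {σ} θ⨾σ = trans (⟨⟩-⨾ t θ σ) (⟨⟩-cong t (λ x _ → θ⨾σ x))

  mutual
    ∈ᵥ-⟨⟩⁻ : ∀ t {σ y} → y ∈ᵥ (t ⟨ σ ⟩) → ∃ λ x → x ∈ᵥ t × y ∈ᵥ σ x
    ∈ᵥ-⟨⟩⁻ (var x)   m          = x , here , m
    ∈ᵥ-⟨⟩⁻ (fn f ts) (inside m) = Product.map₂ (Product.map₁ inside) (∈ᵥ*-⟨⟩⁻ ts m)

    ∈ᵥ*-⟨⟩⁻ : ∀ {n} (ts : Vec Term n) {σ y} → y ∈ᵥ* (ts ⟨ σ ⟩*) → ∃ λ x → x ∈ᵥ* ts × y ∈ᵥ σ x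
    ∈ᵥ*-⟨⟩⁻ (t ∷ ts) (hd m) = Product.map₂ (Product.map₁ hd) (∈ᵥ-⟨⟩⁻ t m)
    ∈ᵥ*-⟨⟩⁻ (t ∷ ts) (tl m) = Product.map₂ (Product.map₁ tl) (∈ᵥ*-⟨⟩⁻ ts m)

  mutual
    ∈ᵥ-⟨⟩⁺ : ∀ {t σ x y} → x ∈ᵥ t → y ∈ᵥ σ x → y ∈ᵥ (t ⟨ σ ⟩)
    ∈ᵥ-⟨⟩⁺ here       n = n
    ∈ᵥ-⟨⟩⁺ (inside m) n = inside (∈ᵥ*-⟨⟩⁺ m n)

    ∈ᵥ*-⟨⟩⁺ : ∀ {k} {ts : Vec Term k} {σ x y} → x ∈ᵥ* ts → y ∈ᵥ σ x → y ∈ᵥ* (ts ⟨ σ ⟩*)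
    ∈ᵥ*-⟨⟩⁺ (hd m) n = hd (∈ᵥ-⟨⟩⁺ m n)
    ∈ᵥ*-⟨⟩⁺ (tl m) n = tl (∈ᵥ*-⟨⟩⁺ m n)

  ∈ᵥₐ-⟨⟩⁺ : ∀ A {σ x y} → x ∈ᵥₐ A → y ∈ᵥ σ x → y ∈ᵥₐ (A ⟨ σ ⟩ₐ)
  ∈ᵥₐ-⟨⟩⁺ (atom p ts) = ∈ᵥ*-⟨⟩⁺

  ∈ᵥc-⟨⟩⁺ : ∀ c {σ x y} → x ∈ᵥc c → y ∈ᵥ σ x → y ∈ᵥc (c ⟨ σ ⟩c)
  ∈ᵥc-⟨⟩⁺ (H ⇐ B) (inj₁ m) n = inj₁ (∈ᵥₐ-⟨⟩⁺ H m n)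
  ∈ᵥc-⟨⟩⁺ (H ⇐ B) (inj₂ m) n = inj₂ (Anyₚ.map⁺ (Any.map (λ m′ → ∈ᵥₐ-⟨⟩⁺ _ m′ n) m))

  mutual
    _∈ᵥ?_ : ∀ x t → Dec (x ∈ᵥ t)
    x ∈ᵥ? var y   = map′ (λ { refl → here }) (λ { here → refl }) (x ≟ y)
    x ∈ᵥ? fn f ts = map′ inside (λ { (inside m) → m }) (x ∈ᵥ*? ts)

    _∈ᵥ*?_ : ∀ x {n} (ts : Vec Term n) → Dec (x ∈ᵥ* ts)
    x ∈ᵥ*? []       = no λ ()
    x ∈ᵥ*? (t ∷ ts) = map′ [ hd , tl ]′ (λ { (hd m) → inj₁ m ; (tl m) → inj₂ m })
                           (x ∈ᵥ? t ⊎-dec x ∈ᵥ*? ts)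

  _∈ᵥₐ?_ : ∀ x A → Dec (x ∈ᵥₐ A)
  x ∈ᵥₐ? atom p ts = x ∈ᵥ*? ts

  _∈ᵥc?_ : ∀ x c → Dec (x ∈ᵥc c)
  x ∈ᵥc? (H ⇐ B) = x ∈ᵥₐ? H ⊎-dec Any.any? (x ∈ᵥₐ?_) B

  lookup-⟨⟩* : ∀ {n} (ts : Vec Term n) {σ} i → lookup (ts ⟨ σ ⟩*) i ≡ lookup ts i ⟨ σ ⟩
  lookup-⟨⟩* (t ∷ ts) Fin.zero    = refl
  lookup-⟨⟩* (t ∷ ts) (Fin.suc i) = lookup-⟨⟩* ts i

  lookup-⟨⟩*² : ∀ {n} (ts : Vec Term n) {θ σ} i →
                lookup (ts ⟨ θ ⟩* ⟨ σ ⟩*) i ≡ lookup ts i ⟨ θ ⟩ ⟨ σ ⟩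
  lookup-⟨⟩*² ts {θ} {σ} i = trans (lookup-⟨⟩* (ts ⟨ θ ⟩*) i) (cong _⟨ σ ⟩ (lookup-⟨⟩* ts i))

  ∈ᵥ*-lookup : ∀ {n} (ts : Vec Term n) i {x} → x ∈ᵥ lookup ts i → x ∈ᵥ* ts
  ∈ᵥ*-lookup (t ∷ ts) Fin.zero    m = hd m
  ∈ᵥ*-lookup (t ∷ ts) (Fin.suc i) m = tl (∈ᵥ*-lookup ts i m)

  IsInstance-⟨⟩ : ∀ {s u} σ → IsInstance s u → IsInstance (s ⟨ σ ⟩) u
  IsInstance-⟨⟩ {u = u} σ (α , refl) = α ⨾ σ , ⟨⟩-⨾ u α σ

  IsInstance-trans : ∀ {t u s} → IsInstance t u → IsInstance u s → IsInstance t s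
  IsInstance-trans {s = s} (α , refl) (β , refl) = β ⨾ α , ⟨⟩-⨾ s β α

  -- Unification

  fn-injectiveˡ : ∀ {f g us vs} → fn f us ≡ fn g vs → f ≡ g
  fn-injectiveˡ refl = refl

  fn-injectiveʳ : ∀ {f us vs} → fn f us ≡ fn f vs → us ≡ vs
  fn-injectiveʳ refl = refl

  atom-injectiveˡ : ∀ {p q us vs} → atom p us ≡ atom q vs → p ≡ q
  atom-injectiveˡ refl = refl

  atom-injectiveʳ : ∀ {p us vs} → atom p us ≡ atom p vs → us ≡ vs
  atom-injectiveʳ refl = refl

  mutual
    size : Term → ℕ
    size (var x)   = 1
    size (fn f ts) = suc (size* ts)

    size* : ∀ {n} → Vec Term n → ℕ
    size* []       = 0
    size* (t ∷ ts) = size t + size* ts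

  mutual
    size-∈ᵥ : ∀ t {σ x} → x ∈ᵥ t → size (σ x) ≤ size (t ⟨ σ ⟩)
    size-∈ᵥ (var x)   here       = ≤-refl
    size-∈ᵥ (fn f ts) (inside m) = m≤n⇒m≤1+n (size*-∈ᵥ ts m)

    size*-∈ᵥ : ∀ {n} (ts : Vec Term n) {σ x} → x ∈ᵥ* ts → size (σ x) ≤ size* (ts ⟨ σ ⟩*)
    size*-∈ᵥ (t ∷ ts) (hd m) = ≤-trans (size-∈ᵥ t m) (m≤m+n _ _)
    size*-∈ᵥ (t ∷ ts) (tl m) = ≤-trans (size*-∈ᵥ ts m) (m≤n+m _ _)

  occurs-check : ∀ t {σ x} → σ x ≡ t ⟨ σ ⟩ → x ∈ᵥ t → t ≡ var x
  occurs-check (var x)   _ here       = refl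
  occurs-check (fn f ts) e (inside m) =
    contradiction (s≤s (size*-∈ᵥ ts m)) (<-irrefl (cong size e))

  Equations : Set
  Equations = List (Term × Term)

  Unifies : Subst → Equations → Set
  Unifies σ = All λ (s , t) → s ⟨ σ ⟩ ≡ t ⟨ σ ⟩

  _∈ᵥₑ_ : ℕ → Equations → Set
  x ∈ᵥₑ E = Any (λ (s , t) → x ∈ᵥ s ⊎ x ∈ᵥ t) E

  _⟨_⟩ₑ : Equations → Subst → Equations
  []            ⟨ θ ⟩ₑ = []
  ((s , t) ∷ E) ⟨ θ ⟩ₑ = (s ⟨ θ ⟩ , t ⟨ θ ⟩) ∷ E ⟨ θ ⟩ₑ

  _≐*_ : ∀ {n} → Vec Term n → Vec Term n → Equations
  []       ≐* []       = []
  (s ∷ ss) ≐* (t ∷ ts) = (s , t) ∷ ss ≐* ts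

  sizeₑ : Equations → ℕ
  sizeₑ []            = 0
  sizeₑ ((s , t) ∷ E) = size s + size t + sizeₑ E

  Unifies-cong : ∀ E {σ σ′} → σ ≗ σ′ → Unifies σ E → Unifies σ′ E
  Unifies-cong []            σ≗σ′ []      = []
  Unifies-cong ((s , t) ∷ E) σ≗σ′ (e ∷ u) =
    trans (⟨⟩-cong s (λ x _ → sym (σ≗σ′ x))) (trans e (⟨⟩-cong t (λ x _ → σ≗σ′ x)))
    ∷ Unifies-cong E σ≗σ′ u

  Unifies-⟨⟩ₑ⁺ : ∀ E {θ σ} → Unifies (θ ⨾ σ) E → Unifies σ (E ⟨ θ ⟩ₑ)
  Unifies-⟨⟩ₑ⁺ []            []      = []
  Unifies-⟨⟩ₑ⁺ ((s , t) ∷ E) {θ} {σ} (e ∷ u) =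
    trans (⟨⟩-⨾ s θ σ) (trans e (sym (⟨⟩-⨾ t θ σ))) ∷ Unifies-⟨⟩ₑ⁺ E u

  Unifies-⟨⟩ₑ⁻ : ∀ E {θ σ} → Unifies σ (E ⟨ θ ⟩ₑ) → Unifies (θ ⨾ σ) E
  Unifies-⟨⟩ₑ⁻ []            []      = []
  Unifies-⟨⟩ₑ⁻ ((s , t) ∷ E) {θ} {σ} (e ∷ u) =
    trans (sym (⟨⟩-⨾ s θ σ)) (trans e (⟨⟩-⨾ t θ σ)) ∷ Unifies-⟨⟩ₑ⁻ E u

  ∈ᵥₑ-⟨⟩ₑ⁻ : ∀ E {θ y} → y ∈ᵥₑ (E ⟨ θ ⟩ₑ) → ∃ λ x → x ∈ᵥₑ E × y ∈ᵥ θ x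
  ∈ᵥₑ-⟨⟩ₑ⁻ ((s , t) ∷ E) (here (inj₁ m)) =
    Product.map₂ (Product.map₁ (λ m′ → here (inj₁ m′))) (∈ᵥ-⟨⟩⁻ s m)
  ∈ᵥₑ-⟨⟩ₑ⁻ ((s , t) ∷ E) (here (inj₂ m)) =
    Product.map₂ (Product.map₁ (λ m′ → here (inj₂ m′))) (∈ᵥ-⟨⟩⁻ t m)
  ∈ᵥₑ-⟨⟩ₑ⁻ ((s , t) ∷ E) (there m)       = Product.map₂ (Product.map₁ there) (∈ᵥₑ-⟨⟩ₑ⁻ E m)

  Unifies-≐*⁺ : ∀ {n} (ss ts : Vec Term n) {σ} → ss ⟨ σ ⟩* ≡ ts ⟨ σ ⟩* → Unifies σ (ss ≐* ts)
  Unifies-≐*⁺ []       []       e = []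
  Unifies-≐*⁺ (s ∷ ss) (t ∷ ts) e with ∷-injective e
  ... | s≡t , ss≡ts = s≡t ∷ Unifies-≐*⁺ ss ts ss≡ts

  Unifies-≐*⁻ : ∀ {n} (ss ts : Vec Term n) {σ} → Unifies σ (ss ≐* ts) → ss ⟨ σ ⟩* ≡ ts ⟨ σ ⟩*
  Unifies-≐*⁻ []       []       []      = refl
  Unifies-≐*⁻ (s ∷ ss) (t ∷ ts) (e ∷ u) = cong₂ _∷_ e (Unifies-≐*⁻ ss ts u)

  ∈ᵥₑ-≐*⁻ : ∀ {n} (ss ts : Vec Term n) {x} → x ∈ᵥₑ (ss ≐* ts) → x ∈ᵥ* ss ⊎ x ∈ᵥ* ts
  ∈ᵥₑ-≐*⁻ []       []       ()
  ∈ᵥₑ-≐*⁻ (s ∷ ss) (t ∷ ts) (here m)  = Data.Sum.map hd hd m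
  ∈ᵥₑ-≐*⁻ (s ∷ ss) (t ∷ ts) (there m) = Data.Sum.map tl tl (∈ᵥₑ-≐*⁻ ss ts m)

  sizeₑ-++ : ∀ E E′ → sizeₑ (E ++ E′) ≡ sizeₑ E + sizeₑ E′
  sizeₑ-++ []            E′ = refl
  sizeₑ-++ ((s , t) ∷ E) E′ rewrite sizeₑ-++ E E′ = sym (+-assoc (size s + size t) _ _)

  sizeₑ-≐* : ∀ {n} (ss ts : Vec Term n) → sizeₑ (ss ≐* ts) ≡ size* ss + size* ts
  sizeₑ-≐* []       []       = refl
  sizeₑ-≐* (s ∷ ss) (t ∷ ts) rewrite sizeₑ-≐* ss ts =
    interchange (size s) (size t) (size* ss) (size* ts)

  sizeₑ-tail : ∀ s t E → sizeₑ E < sizeₑ ((s , t) ∷ E)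
  sizeₑ-tail (var x)   t E = s≤s (m≤n+m (sizeₑ E) (size t))
  sizeₑ-tail (fn f ss) t E = s≤s (m≤n+m (sizeₑ E) (size* ss + size t))

  sizeₑ-decompose : ∀ {f} (ss ts : Vec Term (farity f)) E →
                    sizeₑ (ss ≐* ts ++ E) < sizeₑ ((fn f ss , fn f ts) ∷ E)
  sizeₑ-decompose ss ts E rewrite sizeₑ-++ (ss ≐* ts) E | sizeₑ-≐* ss ts =
    s≤s (+-monoˡ-≤ (sizeₑ E) (+-monoʳ-≤ (size* ss) (n≤1+n (size* ts))))

  _≔_ : ℕ → Term → Subst
  (x ≔ t) y with x ≟ y
  ... | yes _ = t
  ... | no  _ = var y

  ≔-here : ∀ x t → (x ≔ t) x ≡ t
  ≔-here x t with x ≟ x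
  ... | yes _   = refl
  ... | no  x≢x = contradiction refl x≢x

  ≔-there : ∀ {x y} t → x ≢ y → (x ≔ t) y ≡ var y
  ≔-there {x} {y} t x≢y with x ≟ y
  ... | yes x≡y = contradiction x≡y x≢y
  ... | no  _   = refl

  ≔-⨾ : ∀ {x t σ} → σ x ≡ t ⟨ σ ⟩ → (x ≔ t) ⨾ σ ≗ σ
  ≔-⨾ {x} {t} e y with x ≟ y
  ... | yes refl = sym e
  ... | no  _    = refl

  ≔-fresh : ∀ {x} s t → ¬ x ∈ᵥ s → s ⟨ x ≔ t ⟩ ≡ s
  ≔-fresh s t x∉s = trans (⟨⟩-cong s (λ y y∈s → ≔-there t λ { refl → x∉s y∈s })) (⟨var⟩ s)

  ∈ᵥ-≔ : ∀ {x t y} z → y ∈ᵥ (x ≔ t) z → (x ≡ z × y ∈ᵥ t) ⊎ (y ≡ z × x ≢ z)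
  ∈ᵥ-≔ {x} z m with x ≟ z
  ∈ᵥ-≔ z m    | yes x≡z = inj₁ (x≡z , m)
  ∈ᵥ-≔ z here | no  x≢z = inj₂ (refl , x≢z)

  Unifies-≔ : ∀ E {x t σ} → σ x ≡ t ⟨ σ ⟩ → Unifies σ E → Unifies σ (E ⟨ x ≔ t ⟩ₑ)
  Unifies-≔ E {x} {t} e u = Unifies-⟨⟩ₑ⁺ E (Unifies-cong E (sym ∘ ≔-⨾ {x} {t} e) u)

  record MostGeneralUnifier (E : Equations) : Set where
    field
      mgu     : Subst
      unifies : Unifies mgu E
      factors : ∀ σ → Unifies σ E → mgu ⨾ σ ≗ σ
      finite  : FiniteSubst mgu

  mgu-[] : MostGeneralUnifier []
  mgu-[] = record
    { mgu     = var
    ; unifies = []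
    ; factors = λ _ _ _ → refl
    ; finite  = 0 , λ _ _ → refl }

  mgu-drop : ∀ {E} x → MostGeneralUnifier E → MostGeneralUnifier ((var x , var x) ∷ E)
  mgu-drop x M = record
    { mgu     = mgu
    ; finite  = finite
    ; unifies = refl ∷ unifies
    ; factors = λ { σ (_ ∷ u) → factors σ u } }
    where open MostGeneralUnifier M

  mgu-swap : ∀ {s t E} → MostGeneralUnifier ((s , t) ∷ E) → MostGeneralUnifier ((t , s) ∷ E)
  mgu-swap M = record
    { mgu     = mgu
    ; finite  = finite
    ; unifies = sym (All.head unifies) ∷ All.tail unifies
    ; factors = λ { σ (e ∷ u) → factors σ (sym e ∷ u) } }
    where open MostGeneralUnifier M

  mgu-decompose : ∀ {f} {ss ts : Vec Term (farity f)} {E} →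
                  MostGeneralUnifier (ss ≐* ts ++ E) → MostGeneralUnifier ((fn f ss , fn f ts) ∷ E)
  mgu-decompose {f} {ss} {ts} M = record
    { mgu     = mgu
    ; finite  = finite
    ; unifies = cong (fn f) (Unifies-≐*⁻ ss ts (Allₚ.++⁻ˡ _ unifies)) ∷ Allₚ.++⁻ʳ _ unifies
    ; factors = λ { σ (e ∷ u) → factors σ (Allₚ.++⁺ (Unifies-≐*⁺ ss ts (fn-injectiveʳ e)) u) } }
    where open MostGeneralUnifier M

  mgu-bind : ∀ {x t E} → ¬ x ∈ᵥ t → MostGeneralUnifier (E ⟨ x ≔ t ⟩ₑ) →
             MostGeneralUnifier ((var x , t) ∷ E)
  mgu-bind {x} {t} {E} x∉t M = record
    { mgu     = (x ≔ t) ⨾ mgu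
    ; unifies = binds-x ∷ Unifies-⟨⟩ₑ⁻ E unifies
    ; factors = λ { σ (e ∷ u) y →
        trans (⟨⟩-absorb ((x ≔ t) y) (factors σ (Unifies-≔ E e u))) (≔-⨾ {x} {t} e y) }
    ; finite  = suc x ⊔ N , stable }
    where
    open MostGeneralUnifier M
    N = proj₁ finite

    binds-x : ((x ≔ t) ⨾ mgu) x ≡ t ⟨ (x ≔ t) ⨾ mgu ⟩
    binds-x = begin
      (x ≔ t) x ⟨ mgu ⟩       ≡⟨ cong _⟨ mgu ⟩ (≔-here x t) ⟩
      t ⟨ mgu ⟩               ≡⟨ cong _⟨ mgu ⟩ (≔-fresh t t x∉t) ⟨
      t ⟨ x ≔ t ⟩ ⟨ mgu ⟩     ≡⟨ ⟨⟩-⨾ t (x ≔ t) mgu ⟩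
      t ⟨ (x ≔ t) ⨾ mgu ⟩     ∎

    stable : ∀ y → suc x ⊔ N ≤ y → ((x ≔ t) ⨾ mgu) y ≡ var y
    stable y le = trans (cong _⟨ mgu ⟩ (≔-there {x} t λ { refl → n≮n x (m⊔n≤o⇒m≤o (suc x) N le) }))
                        (proj₂ finite y (m⊔n≤o⇒n≤o (suc x) N le))

  -- The unifier σ stays fixed; it only rules out clashes and failed occurs checks. Eliminating
  -- a variable removes it from the list Vs covering all variables, every other step decreases
  -- the size of the equations.
  module Solve (σ : Subst) where

    Covers : List ℕ → Equations → Set
    Covers Vs E = ∀ {x} → x ∈ᵥₑ E → x ∈ Vs

    mutual
      solve : ∀ k {Vs} → length Vs ≤ k → ∀ E → Covers Vs E → Unifies σ E → Acc _<_ (sizeₑ E) →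
              MostGeneralUnifier E
      solve k l []                          cov u       a        = mgu-[]
      solve k l ((var x , t) ∷ E)           cov (e ∷ u) (acc rs) =
        solve-var k l x t E cov e u (rs (sizeₑ-tail (var x) t E))
      solve k l ((fn f ss , var y) ∷ E)     cov (e ∷ u) (acc rs) =
        mgu-swap (solve-var k l y (fn f ss) E (cov ∘ swap) (sym e) u
                            (rs (sizeₑ-tail (fn f ss) (var y) E)))
        where
        swap : ∀ {z} → z ∈ᵥₑ ((var y , fn f ss) ∷ E) → z ∈ᵥₑ ((fn f ss , var y) ∷ E)
        swap (here m)  = here (Data.Sum.swap m)
        swap (there m) = there m
      solve k l ((fn f ss , fn g ts) ∷ E)   cov (e ∷ u) (acc rs) with fn-injectiveˡ e
      ... | refl = mgu-decompose (solve k l (ss ≐* ts ++ E) (cov ∘ decomposed)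
                                        (Allₚ.++⁺ (Unifies-≐*⁺ ss ts (fn-injectiveʳ e)) u)
                                        (rs (sizeₑ-decompose ss ts E)))
        where
        decomposed : ∀ {z} → z ∈ᵥₑ (ss ≐* ts ++ E) → z ∈ᵥₑ ((fn f ss , fn f ts) ∷ E)
        decomposed m with Anyₚ.++⁻ (ss ≐* ts) m
        ... | inj₂ m′ = there m′
        ... | inj₁ m′ = here (Data.Sum.map inside inside (∈ᵥₑ-≐*⁻ ss ts m′))

      solve-var : ∀ k {Vs} → length Vs ≤ k → ∀ x t E → Covers Vs ((var x , t) ∷ E) →
                  σ x ≡ t ⟨ σ ⟩ → Unifies σ E → Acc _<_ (sizeₑ E) →
                  MostGeneralUnifier ((var x , t) ∷ E)
      solve-var k l x t E cov e u a with x ∈ᵥ? t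
      ... | no  x∉t = eliminate k l x t E cov e u x∉t
      ... | yes x∈t with occurs-check t e x∈t
      ...   | refl = mgu-drop x (solve k l E (cov ∘ there) u a)

      eliminate : ∀ k {Vs} → length Vs ≤ k → ∀ x t E → Covers Vs ((var x , t) ∷ E) →
                  σ x ≡ t ⟨ σ ⟩ → Unifies σ E → ¬ x ∈ᵥ t → MostGeneralUnifier ((var x , t) ∷ E)
      eliminate zero {[]} _ x t E cov e u x∉t with cov (here (inj₁ here))
      ... | ()
      eliminate (suc k) {Vs} l x t E cov e u x∉t =
        mgu-bind x∉t (solve k shorter (E ⟨ x ≔ t ⟩ₑ) covers (Unifies-≔ E e u) (<-wellFounded _))
        where
        x≢? = ¬? ∘ (x ≟_)

        shorter : length (filter x≢? Vs) ≤ k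
        shorter = ≤-pred (<-≤-trans (filter-notAll x≢? Vs (Any.map (λ x≡v x≢v → x≢v x≡v) x∈Vs)) l)
          where x∈Vs = cov (here (inj₁ here))

        covers : Covers (filter x≢? Vs) (E ⟨ x ≔ t ⟩ₑ)
        covers m with ∈ᵥₑ-⟨⟩ₑ⁻ E m
        ... | z , z∈E , n with ∈ᵥ-≔ {x} {t} z n
        ... | inj₁ (refl , y∈t) = ∈-filter⁺ x≢? (cov (here (inj₂ y∈t))) λ { refl → x∉t y∈t }
        ... | inj₂ (refl , x≢z) = ∈-filter⁺ x≢? (cov (there z∈E)) x≢z

  mutual
    vars : Term → List ℕ
    vars (var x)   = x ∷ []
    vars (fn f ts) = vars* ts

    vars* : ∀ {n} → Vec Term n → List ℕ
    vars* []       = []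
    vars* (t ∷ ts) = vars t ++ vars* ts

  mutual
    vars-complete : ∀ t {x} → x ∈ᵥ t → x ∈ vars t
    vars-complete (var x)   here       = here refl
    vars-complete (fn f ts) (inside m) = vars*-complete ts m

    vars*-complete : ∀ {n} (ts : Vec Term n) {x} → x ∈ᵥ* ts → x ∈ vars* ts
    vars*-complete (t ∷ ts) (hd m) = Anyₚ.++⁺ˡ (vars-complete t m)
    vars*-complete (t ∷ ts) (tl m) = Anyₚ.++⁺ʳ (vars t) (vars*-complete ts m)

  varsₑ : Equations → List ℕ
  varsₑ []            = []
  varsₑ ((s , t) ∷ E) = vars s ++ vars t ++ varsₑ E

  varsₑ-complete : ∀ E {x} → x ∈ᵥₑ E → x ∈ varsₑ E
  varsₑ-complete ((s , t) ∷ E) (here (inj₁ m)) = Anyₚ.++⁺ˡ (vars-complete s m)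
  varsₑ-complete ((s , t) ∷ E) (here (inj₂ m)) = Anyₚ.++⁺ʳ (vars s) (Anyₚ.++⁺ˡ (vars-complete t m))
  varsₑ-complete ((s , t) ∷ E) (there m)       =
    Anyₚ.++⁺ʳ (vars s) (Anyₚ.++⁺ʳ (vars t) (varsₑ-complete E m))

  unify : ∀ E σ → Unifies σ E → MostGeneralUnifier E
  unify E σ u = Solve.solve σ _ ≤-refl E (varsₑ-complete E) u (<-wellFounded _)

  unify-atoms : ∀ A B σ → A ⟨ σ ⟩ₐ ≡ B ⟨ σ ⟩ₐ →
                Σ Subst λ θ → IsMGU θ A B × FiniteSubst θ × θ ⨾ σ ≗ σ
  unify-atoms (atom p ss) (atom q ts) σ e with atom-injectiveˡ e
  ... | refl = mgu , (cong (atom p) (Unifies-≐*⁻ ss ts unifies) , most-general) , finite ,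
               factors σ (Unifies-≐*⁺ ss ts (atom-injectiveʳ e))
    where
    open MostGeneralUnifier (unify (ss ≐* ts) σ (Unifies-≐*⁺ ss ts (atom-injectiveʳ e)))
    most-general : ∀ σ′ → atom p ss ⟨ σ′ ⟩ₐ ≡ atom p ts ⟨ σ′ ⟩ₐ → ∃ λ δ → ∀ x → σ′ x ≡ mgu x ⟨ δ ⟩
    most-general σ′ e′ = σ′ , λ x → sym (factors σ′ (Unifies-≐*⁺ ss ts (atom-injectiveʳ e′)) x)

  module _ (τ : PosTerms) where

    Δ-unfiltered : ∀ {q j η s t} → τ q j ≡ nothing → PosCond (Δ[ τ ] q j) η s t → t ≡ s ⟨ η ⟩
    Δ-unfiltered e pc rewrite e = pc

    Δ-filtered : ∀ {q j η s t u} → τ q j ≡ just u → PosCond (Δ[ τ ] q j) η s t → IsInstance s u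
    Δ-filtered e pc rewrite e = pc

    filtered≢unfiltered : ∀ {q i j u} → τ q i ≡ just u → τ q j ≡ nothing → i ≢ j
    filtered≢unfiltered e e′ refl with trans (sym e) e′
    ... | ()

    MGAtomFor-positionwise : ∀ {q η} (ss ts : Vec Term (arity q)) →
      (∀ j → τ q j ≡ nothing → lookup ts j ≡ lookup ss j ⟨ η ⟩) →
      (∀ j {u} → τ q j ≡ just u → IsInstance (lookup ss j) u) →
      MGAtomFor Δ[ τ ] η (atom q ss) (atom q ts)
    MGAtomFor-positionwise {q} {η} ss ts unfiltered filtered = mg ss ts position
      where
      position : ∀ j → PosCond (Δ[ τ ] q j) η (lookup ss j) (lookup ts j)
      position j with τ q j in e
      ... | nothing = unfiltered j e
      ... | just u  = filtered j e

    MGAtomFor-⟨⟩ : ∀ {η θ θ′ σ A′ A} → MGAtomFor Δ[ τ ] η A′ A →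
            (∀ x → x ∈ᵥₐ A′ → (θ′ ⨾ σ) x ≡ (η ⨾ θ) x) →
            MGAtomFor Δ[ τ ] σ (A′ ⟨ θ′ ⟩ₐ) (A ⟨ θ ⟩ₐ)
    MGAtomFor-⟨⟩ {η} {θ} {θ′} {σ} (mg {q} ss ts pc) agree =
      MGAtomFor-positionwise (ss ⟨ θ′ ⟩*) (ts ⟨ θ ⟩*) unfiltered filtered
      where
      unfiltered : ∀ j → τ q j ≡ nothing → lookup (ts ⟨ θ ⟩*) j ≡ lookup (ss ⟨ θ′ ⟩*) j ⟨ σ ⟩
      unfiltered j e = begin
        lookup (ts ⟨ θ ⟩*) j         ≡⟨ lookup-⟨⟩* ts j ⟩
        lookup ts j ⟨ θ ⟩            ≡⟨ cong _⟨ θ ⟩ (Δ-unfiltered e (pc j)) ⟩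
        lookup ss j ⟨ η ⟩ ⟨ θ ⟩      ≡⟨ ⟨⟩-⨾ (lookup ss j) η θ ⟩
        lookup ss j ⟨ η ⨾ θ ⟩        ≡⟨ ⟨⟩-cong (lookup ss j) (λ x → agree x ∘ ∈ᵥ*-lookup ss j) ⟨
        lookup ss j ⟨ θ′ ⨾ σ ⟩       ≡⟨ ⟨⟩-⨾ (lookup ss j) θ′ σ ⟨
        lookup ss j ⟨ θ′ ⟩ ⟨ σ ⟩     ≡⟨ cong _⟨ σ ⟩ (lookup-⟨⟩* ss j) ⟨
        lookup (ss ⟨ θ′ ⟩*) j ⟨ σ ⟩  ∎

      filtered : ∀ j {u} → τ q j ≡ just u → IsInstance (lookup (ss ⟨ θ′ ⟩*) j) u
      filtered j {u} e = subst (λ s → IsInstance s u) (sym (lookup-⟨⟩* ss j))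
                               (IsInstance-⟨⟩ {u = u} θ′ (Δ-filtered e (pc j)))

    MGQueryFor-⟨⟩ : ∀ {η θ θ′ σ Q′ Q} → MGQueryFor Δ[ τ ] η Q′ Q →
             (∀ x → x ∈ᵥq Q′ → (θ′ ⨾ σ) x ≡ (η ⨾ θ) x) →
             Pointwise (λ A′ A → MGAtomFor Δ[ τ ] σ (A′ ⟨ θ′ ⟩ₐ) (A ⟨ θ ⟩ₐ)) Q′ Q
    MGQueryFor-⟨⟩ []       agree = []
    MGQueryFor-⟨⟩ (r ∷ rs) agree =
      MGAtomFor-⟨⟩ r (λ x → agree x ∘ here) ∷ MGQueryFor-⟨⟩ rs (λ x → agree x ∘ there)

  -- Lifting a resolution step

  rename : ℕ ↔ ℕ → Subst
  rename π x = var (Inverse.to π x)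

  module Lift
    (τ : PosTerms) {p : Π} (hs : Vec Term (arity p)) (B : Query)
    (dn : DNClause τ (atom p hs ⇐ B))
    (π π′ : ℕ ↔ ℕ) (θ : Subst) (ts : Vec Term (arity p))
    (selected-unified : ts ⟨ θ ⟩* ≡ hs ⟨ rename π ⟩* ⟨ θ ⟩*)
    (η : Subst) (ts′ : Vec Term (arity p))
    (selected-mg : ∀ i → PosCond (Δ[ τ ] p i) η (lookup ts′ i) (lookup ts i))
    (As′ Cs′ : Query)
    (apart : VarDisjoint ((atom p hs ⇐ B) ⟨ rename π′ ⟩c) (As′ ++ atom p ts′ ∷ Cs′))
    where

    c : Clause
    c = atom p hs ⇐ B

    ρ ρ′ : Subst
    ρ  = rename π
    ρ′ = rename π′

    separated : ∀ {i u j x} → τ p i ≡ just u → i ≢ j → x ∈ᵥ lookup hs i → ¬ x ∈ᵥ lookup hs j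
    separated e i≢j = proj₁ dn _ _ e _ i≢j _

    generalizes : ∀ {i u} → τ p i ≡ just u → MoreGeneralTerm (lookup hs i) u
    generalizes e = proj₁ (proj₂ dn) _ _ e

    body-separated : ∀ {i u q bs j x} → τ p i ≡ just u → atom q bs ∈ B → τ q j ≡ nothing →
                     x ∈ᵥ lookup hs i → ¬ x ∈ᵥ lookup bs j
    body-separated e b∈B e′ = proj₁ (proj₂ (proj₂ dn)) _ _ e _ _ b∈B _ e′ _

    body-instance : ∀ {q bs j u} → atom q bs ∈ B → τ q j ≡ just u → IsInstance (lookup bs j) u
    body-instance b∈B e = proj₂ (proj₂ (proj₂ dn)) _ _ b∈B _ _ e

    matcher : ∀ i → Σ Subst λ κ → ∀ {u} → τ p i ≡ just u → lookup ts′ i ≡ lookup hs i ⟨ κ ⟩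
    matcher i with τ p i in e
    ... | nothing = var , λ ()
    ... | just u  = proj₁ instance-of-hs , λ { refl → proj₂ instance-of-hs }
      where
      instance-of-hs : IsInstance (lookup ts′ i) (lookup hs i)
      instance-of-hs =
        IsInstance-trans {u = u} {s = lookup hs i} (Δ-filtered τ e (selected-mg i)) (generalizes e)

    κ : Fin (arity p) → Subst
    κ i = proj₁ (matcher i)

    InFilteredArg : ℕ → Fin (arity p) → Set
    InFilteredArg x i = ∃ λ u → τ p i ≡ just u × x ∈ᵥ lookup hs i

    inFilteredArg? : ∀ x i → Dec (InFilteredArg x i)
    inFilteredArg? x i with τ p i in e
    ... | nothing = no λ { (_ , () , _) }
    ... | just u  = map′ (λ m → u , refl , m) (λ { (_ , _ , m) → m }) (x ∈ᵥ? lookup hs i)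

    -- DN1 makes the filtered position found by the search unique.
    γ : Subst
    γ x with any? (inFilteredArg? x)
    ... | yes (i , _) = (κ i ⨾ (η ⨾ θ)) x
    ... | no  _       = (ρ ⨾ θ) x

    γ-inFilteredArg : ∀ {i u x} → τ p i ≡ just u → x ∈ᵥ lookup hs i → γ x ≡ (κ i ⨾ (η ⨾ θ)) x
    γ-inFilteredArg {i} {u} {x} e m with any? (inFilteredArg? x)
    ... | no  outside          = contradiction (i , u , e , m) outside
    ... | yes (j , _ , _ , m′) with i Fin.≟ j
    ...   | yes refl = refl
    ...   | no  i≢j  = contradiction m′ (separated e i≢j m)

    γ-notInFilteredArg : ∀ {x} → (∀ i → ¬ InFilteredArg x i) → γ x ≡ (ρ ⨾ θ) x
    γ-notInFilteredArg {x} outside with any? (inFilteredArg? x)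
    ... | yes (i , b) = contradiction b (outside i)
    ... | no  _       = refl

    γ-filteredArg : ∀ {i u} → τ p i ≡ just u → lookup hs i ⟨ γ ⟩ ≡ lookup ts′ i ⟨ η ⨾ θ ⟩
    γ-filteredArg {i} e = begin
      lookup hs i ⟨ γ ⟩              ≡⟨ ⟨⟩-cong (lookup hs i) (λ x → γ-inFilteredArg e) ⟩
      lookup hs i ⟨ κ i ⨾ (η ⨾ θ) ⟩  ≡⟨ ⟨⟩-⨾ (lookup hs i) (κ i) (η ⨾ θ) ⟨
      lookup hs i ⟨ κ i ⟩ ⟨ η ⨾ θ ⟩  ≡⟨ cong _⟨ η ⨾ θ ⟩ (proj₂ (matcher i) e) ⟨
      lookup ts′ i ⟨ η ⨾ θ ⟩         ∎

    γ-unfilteredTerm : ∀ s → (∀ {x} → x ∈ᵥ s → ∀ i → ¬ InFilteredArg x i) → s ⟨ γ ⟩ ≡ s ⟨ ρ ⟩ ⟨ θ ⟩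
    γ-unfilteredTerm s outside =
      trans (⟨⟩-cong s (λ x → γ-notInFilteredArg ∘ outside)) (sym (⟨⟩-⨾ s ρ θ))

    σ : Subst
    σ y with Inverse.from π′ y ∈ᵥc? c
    ... | yes _ = γ (Inverse.from π′ y)
    ... | no  _ = (η ⨾ θ) y

    σ-renamed : ∀ s → (∀ {x} → x ∈ᵥ s → x ∈ᵥc c) → s ⟨ ρ′ ⟩ ⟨ σ ⟩ ≡ s ⟨ γ ⟩
    σ-renamed s in-c = trans (⟨⟩-⨾ s ρ′ σ) (⟨⟩-cong s (λ x m → renamed-var (in-c m)))
      where
      renamed-var : ∀ {x} → x ∈ᵥc c → σ (Inverse.to π′ x) ≡ γ x
      renamed-var {x} m
        with Inverse.from π′ (Inverse.to π′ x) ∈ᵥc? c | Inverse.strictlyInverseʳ π′ x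
      ... | yes _ | from∘to = cong γ from∘to
      ... | no  m̸ | from∘to = contradiction (subst (_∈ᵥc c) (sym from∘to) m) m̸

    Q′ : Query
    Q′ = As′ ++ atom p ts′ ∷ Cs′

    σ-query : ∀ {y} → y ∈ᵥq Q′ → σ y ≡ (η ⨾ θ) y
    σ-query {y} m with Inverse.from π′ y ∈ᵥc? c
    ... | no  _  = refl
    ... | yes m′ = contradiction m (apart y (∈ᵥc-⟨⟩⁺ c m′ renamed-back))
      where
      renamed-back : y ∈ᵥ ρ′ (Inverse.from π′ y)
      renamed-back = subst (λ z → y ∈ᵥ var z) (sym (Inverse.strictlyInverseˡ π′ y)) here

    clause-matches : ∀ i → lookup ts′ i ⟨ η ⨾ θ ⟩ ≡ lookup hs i ⟨ γ ⟩
    clause-matches i with τ p i in e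
    ... | just u  = sym (γ-filteredArg e)
    ... | nothing = begin
      lookup ts′ i ⟨ η ⨾ θ ⟩       ≡⟨ ⟨⟩-⨾ (lookup ts′ i) η θ ⟨
      lookup ts′ i ⟨ η ⟩ ⟨ θ ⟩     ≡⟨ cong _⟨ θ ⟩ (Δ-unfiltered τ e (selected-mg i)) ⟨
      lookup ts i ⟨ θ ⟩            ≡⟨ lookup-⟨⟩* ts i ⟨
      lookup (ts ⟨ θ ⟩*) i         ≡⟨ cong (λ vs → lookup vs i) selected-unified ⟩
      lookup (hs ⟨ ρ ⟩* ⟨ θ ⟩*) i  ≡⟨ lookup-⟨⟩*² hs i ⟩
      lookup hs i ⟨ ρ ⟩ ⟨ θ ⟩      ≡⟨ γ-unfilteredTerm (lookup hs i) outside ⟨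
      lookup hs i ⟨ γ ⟩            ∎
      where
      outside : ∀ {x} → x ∈ᵥ lookup hs i → ∀ j → ¬ InFilteredArg x j
      outside m j (_ , e′ , m′) = separated e′ (filtered≢unfiltered τ e′ e) m′ m

    lifted-unifier : atom p ts′ ⟨ σ ⟩ₐ ≡ head (c ⟨ ρ′ ⟩c) ⟨ σ ⟩ₐ
    lifted-unifier = cong (atom p) (lookup-extensionality _ _ λ i → begin
      lookup (ts′ ⟨ σ ⟩*) i         ≡⟨ lookup-⟨⟩* ts′ i ⟩
      lookup ts′ i ⟨ σ ⟩            ≡⟨ ⟨⟩-cong (lookup ts′ i) (λ y m → σ-query (in-query i m)) ⟩
      lookup ts′ i ⟨ η ⨾ θ ⟩        ≡⟨ clause-matches i ⟩
      lookup hs i ⟨ γ ⟩             ≡⟨ σ-renamed (lookup hs i) (λ m → inj₁ (∈ᵥ*-lookup hs i m)) ⟨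
      lookup hs i ⟨ ρ′ ⟩ ⟨ σ ⟩      ≡⟨ lookup-⟨⟩*² hs i ⟨
      lookup (hs ⟨ ρ′ ⟩* ⟨ σ ⟩*) i  ∎)
      where
      in-query : ∀ i {y} → y ∈ᵥ lookup ts′ i → y ∈ᵥq Q′
      in-query i m = Anyₚ.++⁺ʳ As′ (here (∈ᵥ*-lookup ts′ i m))

    module _ (θ′ : Subst) (θ′⨾σ : θ′ ⨾ σ ≗ σ) where

      lift-query : ∀ {Xs′ Xs} → MGQueryFor Δ[ τ ] η Xs′ Xs → (∀ {x} → x ∈ᵥq Xs′ → x ∈ᵥq Q′) →
                   Pointwise (λ A′ A → MGAtomFor Δ[ τ ] σ (A′ ⟨ θ′ ⟩ₐ) (A ⟨ θ ⟩ₐ)) Xs′ Xs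
      lift-query mgX in-Q′ = MGQueryFor-⟨⟩ τ mgX (λ x m → trans (θ′⨾σ x) (σ-query (in-Q′ m)))

      lift-body : ∀ {b} → b ∈ B → MGAtomFor Δ[ τ ] σ (b ⟨ ρ′ ⟩ₐ ⟨ θ′ ⟩ₐ) (b ⟨ ρ ⟩ₐ ⟨ θ ⟩ₐ)
      lift-body {atom q bs} b∈B =
        MGAtomFor-positionwise τ (bs ⟨ ρ′ ⟩* ⟨ θ′ ⟩*) (bs ⟨ ρ ⟩* ⟨ θ ⟩*) unfiltered filtered
        where
        unfiltered : ∀ j → τ q j ≡ nothing →
                     lookup (bs ⟨ ρ ⟩* ⟨ θ ⟩*) j ≡ lookup (bs ⟨ ρ′ ⟩* ⟨ θ′ ⟩*) j ⟨ σ ⟩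
        unfiltered j e = begin
          lookup (bs ⟨ ρ ⟩* ⟨ θ ⟩*) j          ≡⟨ lookup-⟨⟩*² bs j ⟩
          lookup bs j ⟨ ρ ⟩ ⟨ θ ⟩              ≡⟨ γ-unfilteredTerm (lookup bs j) outside ⟨
          lookup bs j ⟨ γ ⟩                    ≡⟨ σ-renamed (lookup bs j) in-c ⟨
          lookup bs j ⟨ ρ′ ⟩ ⟨ σ ⟩             ≡⟨ ⟨⟩-absorb (lookup bs j ⟨ ρ′ ⟩) θ′⨾σ ⟨
          lookup bs j ⟨ ρ′ ⟩ ⟨ θ′ ⟩ ⟨ σ ⟩      ≡⟨ cong _⟨ σ ⟩ (lookup-⟨⟩*² bs j) ⟨
          lookup (bs ⟨ ρ′ ⟩* ⟨ θ′ ⟩*) j ⟨ σ ⟩  ∎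
          where
          outside : ∀ {x} → x ∈ᵥ lookup bs j → ∀ i → ¬ InFilteredArg x i
          outside m i (_ , e′ , m′) = body-separated e′ b∈B e m′ m

          in-c : ∀ {x} → x ∈ᵥ lookup bs j → x ∈ᵥc c
          in-c m = inj₂ (lose b∈B (∈ᵥ*-lookup bs j m))

        filtered : ∀ j {u} → τ q j ≡ just u → IsInstance (lookup (bs ⟨ ρ′ ⟩* ⟨ θ′ ⟩*) j) u
        filtered j {u} e =
          subst (λ s → IsInstance s u) (sym (lookup-⟨⟩*² bs j))
                (IsInstance-⟨⟩ {u = u} θ′ (IsInstance-⟨⟩ {u = u} ρ′ (body-instance b∈B e)))

      lifted-resolvent : ∀ {As Cs} → MGQueryFor Δ[ τ ] η As′ As → MGQueryFor Δ[ τ ] η Cs′ Cs →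
        MGQueryFor Δ[ τ ] σ ((As′ ++ B ⟨ ρ′ ⟩q ++ Cs′) ⟨ θ′ ⟩q) ((As ++ B ⟨ ρ ⟩q ++ Cs) ⟨ θ ⟩q)
      lifted-resolvent mgAs mgCs =
        Pointwise.map⁺ _⟨ θ′ ⟩ₐ _⟨ θ ⟩ₐ (Pointwise.++⁺ (lift-query mgAs Anyₚ.++⁺ˡ)
          (Pointwise.++⁺ (Pointwise.map⁺ _⟨ ρ′ ⟩ₐ _⟨ ρ ⟩ₐ (Pointwise-diagonal B lift-body))
                         (lift-query mgCs (Anyₚ.++⁺ʳ As′ ∘ there))))

  lift-step : (τ : PosTerms) (c : Clause) → DNClause τ c →
    (As : Query) (p : Π) (ts : Vec Term (arity p)) (Cs : Query)
    (θ : Subst) (Q₁ : Query) (d : Clause) →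
    SLDStep As (atom p ts) Cs c θ Q₁ d →
    (As′ : Query) (ts′ : Vec Term (arity p)) (Cs′ : Query) →
    length As′ ≡ length As →
    MoreGeneralQ Δ[ τ ] (As′ ++ atom p ts′ ∷ Cs′) (As ++ atom p ts ∷ Cs) →
    (c′ : Clause) → Variant c′ c → VarDisjoint c′ (As′ ++ atom p ts′ ∷ Cs′) →
    Σ Subst λ θ′ → Σ Query λ Q′₁ →
      SLDStep As′ (atom p ts′) Cs′ c θ′ Q′₁ c′ ×
      DeltaLift Δ[ τ ] As′ (atom p ts′) Cs′ Q′₁ As (atom p ts) Cs Q₁
  lift-step τ (atom q hs ⇐ B) dn As p ts Cs θ _ _ ((π , refl) , _ , _ , (unified , _) , refl)
            As′ ts′ Cs′ len (η , mgQ) _ (π′ , refl) apart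
    with atom-injectiveˡ unified | Pointwise-++⁻ As′ As len mgQ
  ... | refl | mgAs , mg _ _ selected-mg ∷ mgCs =
    let open Lift τ hs B dn π π′ θ ts (atom-injectiveʳ unified) η ts′ selected-mg As′ Cs′ apart
        (θ′ , θ′-mgu , θ′-finite , θ′⨾σ) = unify-atoms _ _ σ lifted-unifier
    in θ′ , _ , ((π′ , refl) , apart , θ′-finite , θ′-mgu , refl) ,
       (η , mgQ) , (σ , lifted-resolvent θ′ θ′⨾σ mgAs mgCs) , len

proposition7 : (F : Set) (farity : F → ℕ) (Π : Set) (arity : Π → ℕ) →
    let open Defs.Lang F farity Π arity in
    (P : Program) (τ : PosTerms) → DNProgram τ P →
    (c : Clause) → c ∈ P →
    (As : Query) (p : Π) (ts : Vec Term (arity p)) (Cs : Query)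
    (θ : Subst) (Q₁ : Query) (d : Clause) →
    SLDStep As (atom p ts) Cs c θ Q₁ d →
    (As' : Query) (ts' : Vec Term (arity p)) (Cs' : Query) →
    length As' ≡ length As →
    MoreGeneralQ Δ[ τ ] (As' ++ atom p ts' ∷ Cs') (As ++ atom p ts ∷ Cs) →
    (c' : Clause) → Variant c' c → VarDisjoint c' (As' ++ atom p ts' ∷ Cs') →
    Σ Subst λ θ' → Σ Query λ Q'₁ →
      SLDStep As' (atom p ts') Cs' c θ' Q'₁ c' ×
      DeltaLift Δ[ τ ] As' (atom p ts') Cs' Q'₁ As (atom p ts) Cs Q₁
proposition7 F farity Π arity P τ dn c c∈P = lift-step F farity Π arity τ c (dn c c∈P)
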